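{- If $w$ and $w'$ are rich finite words having the same set of palindromic factors, then they are abelianly equivalent, i.e. $|w|_x=|w'|_x$ for every letter $x$.
   Context: A finite word $w$ is rich if it has exactly $|w|+1$ distinct palindromic factors (including the empty word). $|w|_x$ denotes the number of occurrences of the letter $x$ in $w$. -}

module Defs where

open import Level using (Level)
open import Data.Nat using (ℕ; suc)
open import Data.List using (List; _++_; reverse; length; filter)
open import Data.List.Membership.Propositional using (_∈_)
open import Data.List.Relation.Unary.Unique.Propositional using (Unique)
open import Data.Product using (∃; ∃₂; _×_)
open import Relation.Binary.PropositionalEquality using (_≡_)
open import Relation.Binary.Definitions using (DecidableEquality)

module _ {a : Level} {A : Set a} where

  Factor : List A → List A → Set a
  Factor f w = ∃₂ λ u v → u ++ f ++ v ≡ w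

  Palindrome : List A → Set a
  Palindrome p = reverse p ≡ p

  PalFactor : List A → List A → Set a
  PalFactor p w = Palindrome p × Factor p w

  -- The set of palindromic factors of w has exactly n elements
  -- (counting the empty word): there is a duplicate-free list which
  -- enumerates exactly the palindromic factors of w and has length n.
  NumPalFactors : List A → ℕ → Set a
  NumPalFactors w n = ∃ λ (L : List (List A)) →
    Unique L × (∀ p → p ∈ L → PalFactor p w) × (∀ p → PalFactor p w → p ∈ L)
      × length L ≡ n

  Rich : List A → Set a
  Rich w = NumPalFactors w (suc (length w))

  occ : DecidableEquality A → A → List A → ℕ
  occ _≟_ x w = length (filter (x ≟_) w)

module Submission where

open import Defs
open import Level using (Level)
open import Data.List using (List)
open import Data.Product using (_×_)
open import Relation.Binary.PropositionalEquality using (_≡_)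
open import Relation.Binary.Definitions using (DecidableEquality)

open import Data.Bool using (true; false)
open import Data.Empty using (⊥-elim)
open import Data.Nat using (ℕ; suc; _+_; _≤_; z≤n; s≤s)
open import Data.Nat.Properties using (≤-refl; ≤-trans; m≤n⇒m≤1+n; n≮n; ≤-reflexive; suc-injective)
open import Data.Nat.ListAction using (sum)
open import Data.Nat.ListAction.Properties using (sum-↭)
open import Data.List using ([]; _∷_; _++_; reverse; length; filter; map; [_])
open import Data.List.Properties using (≡-dec; reverse-++; unfold-reverse; ++-identityʳ; ++-assoc; ∷-injectiveˡ; ∷-injectiveʳ)
open import Data.List.Membership.Propositional using (_∈_)
open import Data.List.Membership.Propositional.Properties using (∈-filter⁺; ∈-filter⁻; ∈-map⁺; ∈-map⁻)
open import Data.List.Membership.Propositional.Properties.WithK using (unique∧set⇒bag)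
import Data.List.Membership.DecPropositional as DecMembership
open import Data.List.Relation.Unary.Any using (here; there)
open import Data.List.Relation.Unary.All.Properties.Core using (¬Any⇒All¬)
open import Data.List.Relation.Unary.Unique.Propositional using (Unique)
import Data.List.Relation.Unary.AllPairs as AllPairs
import Data.List.Relation.Unary.All as All
open import Data.List.Relation.Binary.BagAndSetEquality using (∼bag⇒↭)
open import Data.List.Relation.Binary.Permutation.Propositional using (_↭_)
open import Data.List.Relation.Binary.Permutation.Propositional.Properties using (↭-length; map⁺)
open import Data.Product using (∃; ∃₂; _,_; proj₁; proj₂)
open import Data.Sum using (_⊎_; inj₁; inj₂)
open import Relation.Nullary using (¬_; does; yes; no)
open import Relation.Nullary.Decidable using (_×-dec_; ¬?)
open import Relation.Unary using (Decidable)
open import Relation.Binary.PropositionalEquality using (refl; sym; trans; cong; module ≡-Reasoning)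
open import Function.Bundles using (mk⇔)

-- Reading a word from right to left, prepending a letter c to a
-- word u creates at most one new palindromic factor, and if it creates
-- one, that palindrome is a prefix of c ∷ u, hence starts with c: of two
-- palindromic prefixes of c ∷ u, the shorter one is also a suffix of the
-- longer one, so it already occurs in u.  Consequently a word w has at
-- most |w| + 1 palindromic factors, and w is rich exactly when every
-- letter creates a new palindrome.  For rich w, the number of nonempty
-- palindromic factors whose first letter is x therefore equals |w|ₓ.
-- That count depends only on the set of palindromic factors, which
-- gives the theorem.

module Words {a : Level} {A : Set a} where

  Prefix : List A → List A → Set a
  Prefix p w = ∃ λ v → p ++ v ≡ w

  prefixes : List A → List (List A)
  prefixes []      = [ [] ]
  prefixes (c ∷ u) = [] ∷ map (c ∷_) (prefixes u)

  prefixes-sound : ∀ w {p} → p ∈ prefixes w → Prefix p w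
  prefixes-sound []      (here refl) = [] , refl
  prefixes-sound (c ∷ u) (here refl) = c ∷ u , refl
  prefixes-sound (c ∷ u) (there m) with ∈-map⁻ (c ∷_) m
  ... | q , mq , refl with prefixes-sound u mq
  ...   | v , refl = v , refl

  prefixes-complete : ∀ w {p} → Prefix p w → p ∈ prefixes w
  prefixes-complete []      {[]}    _          = here refl
  prefixes-complete (c ∷ u) {[]}    _          = here refl
  prefixes-complete (c ∷ u) {d ∷ p} (v , refl) =
    there (∈-map⁺ (c ∷_) (prefixes-complete u (v , refl)))

  factor-∷ : ∀ (c : A) u {f} → Factor f (c ∷ u) → Factor f u ⊎ Prefix f (c ∷ u)
  factor-∷ c u ([]    , v , e)    = inj₂ (v , e)
  factor-∷ c u (d ∷ x , v , refl) = inj₁ (x , v , refl)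

  factor-weaken : ∀ (c : A) u {f} → Factor f u → Factor f (c ∷ u)
  factor-weaken c u (x , v , refl) = c ∷ x , v , refl

  prefixes-comparable : ∀ s t {w} → Prefix s w → Prefix t w →
    (∃ λ y → t ≡ s ++ y) ⊎ (∃ λ y → s ≡ t ++ y)
  prefixes-comparable []      t       _        _        = inj₁ (t , refl)
  prefixes-comparable (x ∷ s) []      _        _        = inj₂ (x ∷ s , refl)
  prefixes-comparable (x ∷ s) (y ∷ t) (v , refl) (v′ , e)
    with ∷-injectiveˡ e | prefixes-comparable s t (v , refl) (v′ , ∷-injectiveʳ e)
  ... | refl | inj₁ (z , e′) = inj₁ (z , cong (y ∷_) e′)
  ... | refl | inj₂ (z , e′) = inj₂ (z , cong (y ∷_) e′)

  pal-prefix-is-suffix : ∀ (s y : List A) → Palindrome s → Palindrome (s ++ y) →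
    s ++ y ≡ reverse y ++ s
  pal-prefix-is-suffix s y pal-s pal-t = begin
    s ++ y                   ≡⟨ sym pal-t ⟩
    reverse (s ++ y)         ≡⟨ reverse-++ s y ⟩
    reverse y ++ reverse s   ≡⟨ cong (reverse y ++_) pal-s ⟩
    reverse y ++ s           ∎
    where open ≡-Reasoning

  reverse-nonempty : ∀ (z : A) zs → ∃₂ λ d e → reverse (z ∷ zs) ≡ d ∷ e
  reverse-nonempty z zs rewrite unfold-reverse z zs with reverse zs
  ... | []    = z , [] , refl
  ... | d ∷ e = d , e ++ [ z ] , refl

  -- The heart of the argument: if a palindrome s is a proper prefix of a
  -- palindromic prefix t of c ∷ u, then s already occurs in u, because it
  -- occurs as a suffix of t starting at a position ≥ 1.
  proper-pal-prefix-in-tail : ∀ s (z : A) zs {c u} → Palindrome s →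
    Palindrome (s ++ z ∷ zs) → Prefix (s ++ z ∷ zs) (c ∷ u) → Factor s u
  proper-pal-prefix-in-tail s z zs {c} {u} pal-s pal-t (v , t++v≡cu)
    with reverse-nonempty z zs
  ... | d , e , rev≡de = e , v , ∷-injectiveʳ (begin
    d ∷ e ++ s ++ v             ≡⟨ sym (++-assoc (d ∷ e) s v) ⟩
    ((d ∷ e) ++ s) ++ v         ≡⟨ cong (λ r → (r ++ s) ++ v) (sym rev≡de) ⟩
    (reverse (z ∷ zs) ++ s) ++ v ≡⟨ cong (_++ v) (sym (pal-prefix-is-suffix s (z ∷ zs) pal-s pal-t)) ⟩
    (s ++ z ∷ zs) ++ v          ≡⟨ t++v≡cu ⟩
    c ∷ u                       ∎)
    where open ≡-Reasoning

same-members⇒↭ : ∀ {a} {B : Set a} {L M : List B} → Unique L → Unique M →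
  (∀ p → p ∈ L → p ∈ M) → (∀ p → p ∈ M → p ∈ L) → L ↭ M
same-members⇒↭ uL uM L⊆M M⊆L = ∼bag⇒↭ (unique∧set⇒bag uL uM (mk⇔ (L⊆M _) (M⊆L _)))

module PalindromicFactors {a : Level} {A : Set a} (_≟_ : DecidableEquality A) where

  open Words
  open DecMembership (≡-dec _≟_) using (_∈?_)

  palindrome? : Decidable (Palindrome {A = A})
  palindrome? p = ≡-dec _≟_ (reverse p) p

  NewPal : List (List A) → List A → Set a
  NewPal Q p = Palindrome p × ¬ p ∈ Q

  newPal? : ∀ Q → Decidable (NewPal Q)
  newPal? Q p = palindrome? p ×-dec ¬? (p ∈? Q)

  extend : List (List A) → List (List A) → List (List A)
  extend []      Q = Q
  extend (g ∷ _) Q = g ∷ Q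

  extend-⊇ : ∀ G {Q p} → p ∈ Q → p ∈ extend G Q
  extend-⊇ []      m = m
  extend-⊇ (_ ∷ _) m = there m

  extend-⊆ : ∀ G {Q p} → p ∈ extend G Q → p ∈ G ⊎ p ∈ Q
  extend-⊆ []      m           = inj₂ m
  extend-⊆ (_ ∷ _) (here refl) = inj₁ (here refl)
  extend-⊆ (_ ∷ _) (there m)   = inj₂ m

  extend-single : ∀ G {Q p} → (∀ {q r} → q ∈ G → r ∈ G → q ≡ r) → p ∈ G → p ∈ extend G Q
  extend-single (g ∷ G) unique-G m = here (unique-G m (here refl))

  extend-unique : ∀ G {Q} → (∀ {q} → q ∈ G → ¬ q ∈ Q) → Unique Q → Unique (extend G Q)
  extend-unique []      _     uQ = uQ
  extend-unique (g ∷ G) fresh uQ = ¬Any⇒All¬ _ (fresh (here refl)) AllPairs.∷ uQ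

  extend-length : ∀ G Q → length (extend G Q) ≤ suc (length Q)
  extend-length []      Q = m≤n⇒m≤1+n ≤-refl
  extend-length (_ ∷ _) Q = ≤-refl

  extend-full : ∀ G {Q n} → length Q ≤ n → length (extend G Q) ≡ suc n →
    ∃ λ q → q ∈ G × extend G Q ≡ q ∷ Q
  extend-full []      Q≤n full = ⊥-elim (n≮n _ (≤-trans (≤-reflexive (sym full)) Q≤n))
  extend-full (g ∷ G) _   _    = g , here refl , refl

  mutual
    -- The enumeration of the palindromic factors of a word: prepending
    -- c to u adds the (at most one) palindromic prefix of c ∷ u not yet
    -- among the palindromic factors of u.
    pals : List A → List (List A)
    pals []      = [ [] ]
    pals (c ∷ u) = extend (newPals c u) (pals u)

    newPals : A → List A → List (List A)
    newPals c u = filter (newPal? (pals u)) (prefixes (c ∷ u))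

  newPals-mem : ∀ c u {q} → q ∈ newPals c u → Prefix q (c ∷ u) × NewPal (pals u) q
  newPals-mem c u m with ∈-filter⁻ (newPal? (pals u)) {xs = prefixes (c ∷ u)} m
  ... | m-pre , new = prefixes-sound (c ∷ u) m-pre , new

  newPals-unique : ∀ c u → (∀ p → PalFactor p u → p ∈ pals u) →
    ∀ {q r} → q ∈ newPals c u → r ∈ newPals c u → q ≡ r
  newPals-unique c u complete-u {q} {r} mq mr
    with newPals-mem c u mq | newPals-mem c u mr
  ... | pre-q , pal-q , new-q | pre-r , pal-r , new-r
    with prefixes-comparable q r pre-q pre-r
  ... | inj₁ ([]     , e) = sym (trans e (++-identityʳ q))
  ... | inj₂ ([]     , e) = trans e (++-identityʳ r)
  ... | inj₁ (z ∷ zs , refl) =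
    ⊥-elim (new-q (complete-u q (pal-q , proper-pal-prefix-in-tail q z zs pal-q pal-r pre-r)))
  ... | inj₂ (z ∷ zs , refl) =
    ⊥-elim (new-r (complete-u r (pal-r , proper-pal-prefix-in-tail r z zs pal-r pal-q pre-q)))

  pals-sound : ∀ w {p} → p ∈ pals w → PalFactor p w
  pals-sound []      (here refl) = refl , [] , [] , refl
  pals-sound (c ∷ u) m with extend-⊆ (newPals c u) m
  ... | inj₁ new with newPals-mem c u new
  ...   | (v , e) , pal , _ = pal , [] , v , e
  pals-sound (c ∷ u) m | inj₂ old with pals-sound u old
  ...   | pal , f = pal , factor-weaken c u f

  pals-complete : ∀ w {p} → PalFactor p w → p ∈ pals w
  pals-complete []      {[]}    _                  = here refl
  pals-complete []      {_ ∷ _} (_ , [] , _ , ())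
  pals-complete []      {_ ∷ _} (_ , _ ∷ _ , _ , ())
  pals-complete (c ∷ u) {p} (pal , f) with factor-∷ c u f | p ∈? pals u
  ... | inj₁ f′  | _      = extend-⊇ (newPals c u) (pals-complete u (pal , f′))
  ... | inj₂ _   | yes m  = extend-⊇ (newPals c u) m
  ... | inj₂ pre | no new =
    extend-single (newPals c u) (newPals-unique c u (λ q → pals-complete u))
      (∈-filter⁺ (newPal? (pals u)) (prefixes-complete (c ∷ u) pre) (pal , new))

  pals-unique : ∀ w → Unique (pals w)
  pals-unique []      = All.[] AllPairs.∷ AllPairs.[]
  pals-unique (c ∷ u) =
    extend-unique (newPals c u) (λ m → proj₂ (proj₂ (newPals-mem c u m))) (pals-unique u)

  pals-bound : ∀ w → length (pals w) ≤ suc (length w)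
  pals-bound []      = s≤s z≤n
  pals-bound (c ∷ u) = ≤-trans (extend-length (newPals c u) (pals u)) (s≤s (pals-bound u))

  -- A new palindrome created by prepending c is a prefix, so it starts
  -- with c (it is nonempty, since the empty word is never new).
  newPals-start : ∀ c u {q} → q ∈ newPals c u → ∃ λ r → q ≡ c ∷ r
  newPals-start c u {[]} m =
    ⊥-elim (proj₂ (proj₂ (newPals-mem c u m)) (pals-complete u (refl , [] , u , refl)))
  newPals-start c u {d ∷ r} m = r , cong (_∷ r) (∷-injectiveˡ (proj₂ (proj₁ (newPals-mem c u m))))

  full-step : ∀ c u → length (pals (c ∷ u)) ≡ suc (suc (length u)) →
    length (pals u) ≡ suc (length u) × ∃ λ r → pals (c ∷ u) ≡ (c ∷ r) ∷ pals u
  full-step c u full with extend-full (newPals c u) (pals-bound u) full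
  ... | q , mq , added with newPals-start c u mq
  ...   | r , refl = suc-injective (trans (cong length (sym added)) full) , r , added

  startsWith : A → List A → ℕ
  startsWith x []      = 0
  startsWith x (d ∷ _) = occ _≟_ x [ d ]

  countStarting : A → List (List A) → ℕ
  countStarting x L = sum (map (startsWith x) L)

  occ-∷ : ∀ x c u → occ _≟_ x (c ∷ u) ≡ occ _≟_ x [ c ] + occ _≟_ x u
  occ-∷ x c u with does (x ≟ c)
  ... | true  = refl
  ... | false = refl

  countStarting-pals : ∀ x w → length (pals w) ≡ suc (length w) →
    countStarting x (pals w) ≡ occ _≟_ x w
  countStarting-pals x []      _    = refl
  countStarting-pals x (c ∷ u) full with full-step c u full
  ... | full-u , r , added = begin
    countStarting x (pals (c ∷ u))          ≡⟨ cong (countStarting x) added ⟩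
    occ _≟_ x [ c ] + countStarting x (pals u) ≡⟨ cong (occ _≟_ x [ c ] +_) (countStarting-pals x u full-u) ⟩
    occ _≟_ x [ c ] + occ _≟_ x u            ≡⟨ sym (occ-∷ x c u) ⟩
    occ _≟_ x (c ∷ u)                        ∎
    where open ≡-Reasoning

  pals-↭ : ∀ w {L} → Unique L → (∀ p → p ∈ L → PalFactor p w) →
    (∀ p → PalFactor p w → p ∈ L) → pals w ↭ L
  pals-↭ w uL sound complete =
    same-members⇒↭ (pals-unique w) uL (λ p m → complete p (pals-sound w m)) (λ p m → pals-complete w (sound p m))

  rich⇒pals-full : ∀ w → Rich w → length (pals w) ≡ suc (length w)
  rich⇒pals-full w (L , uL , sound , complete , len) = trans (↭-length (pals-↭ w uL sound complete)) len

  same-pals⇒↭ : ∀ w w′ → (∀ p → (PalFactor p w → PalFactor p w′) × (PalFactor p w′ → PalFactor p w)) →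
    pals w ↭ pals w′
  same-pals⇒↭ w w′ same =
    pals-↭ w (pals-unique w′) (λ p m → proj₂ (same p) (pals-sound w′ m)) (λ p f → pals-complete w′ (proj₁ (same p) f))

proposition2p7 : {a : Level} {A : Set a} (_≟_ : DecidableEquality A) (w w′ : List A) →
  Rich w → Rich w′ →
  (∀ p → (PalFactor p w → PalFactor p w′) × (PalFactor p w′ → PalFactor p w)) →
  ∀ (x : A) → occ _≟_ x w ≡ occ _≟_ x w′
proposition2p7 _≟_ w w′ rich rich′ same x = begin
  occ _≟_ x w               ≡⟨ sym (countStarting-pals x w (rich⇒pals-full w rich)) ⟩
  countStarting x (pals w)  ≡⟨ sum-↭ (map⁺ (startsWith x) (same-pals⇒↭ w w′ same)) ⟩
  countStarting x (pals w′) ≡⟨ countStarting-pals x w′ (rich⇒pals-full w′ rich′) ⟩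
  occ _≟_ x w′              ∎
  where
    open PalindromicFactors _≟_
    open ≡-Reasoning
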